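{- Let $G$ be a graph with a rooted tree decomposition $(\mathcal{T},\{X_t\}_{t\in V(\mathcal{T})})$ as described in the context. For each bag $t\in V(\mathcal{T})$ let $Y_t\subseteq E_t$ be a set of edges, let $Y=\bigcup_{t\in V(\mathcal{T})}Y_t$, and let $(\Gamma_t,\Delta_t)$ be a pair of connection sets over $X_t$. Then the pairs $\{(\Gamma_t,\Delta_t)\}_t$ satisfy the local connectivity definition $$\Gamma_t=\begin{cases}\emptyset & t\text{ a leaf}\\ \mathrm{tc}(\Gamma_{t'}\cup\Gamma_{t''}\cup Y_t)|_{t} & \text{otherwise,}\end{cases}\qquad \Delta_t=\begin{cases}\Gamma_t & t=\mathrm{root}(\mathcal{T})\\ \mathrm{tc}(\Delta_{p(t)}\cup\Gamma_t)|_{t} & \text{otherwise}\end{cases}$$ for every bag $t$ (where $t',t''$ are the two children of a non-leaf $t$ and $p(t)$ is the parent of $t$) if and only if they satisfy the global connectivity definition $$\Gamma_t=\mathrm{tc}(Y\cap E_{\mathcal{T}_t})|_t,\qquad \Delta_t=\mathrm{tc}(Y)|_t$$ for every bag $t$.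
   Context: A tree decomposition of a graph $G$ is a tree $\mathcal{T}$ with bags $X_t\subseteq V(G)$, $t\in V(\mathcal{T})$, such that every vertex lies in some bag, every edge $uv$ has both endpoints in some bag, and for each vertex $v$ the nodes whose bags contain $v$ induce a connected subtree. The tree $\mathcal{T}$ is rooted at $\mathrm{root}(\mathcal{T})$; every non-leaf node has exactly two children, and $\mathcal{T}_t$ denotes the subtree rooted at $t$. An edge $uv\in E(G)$ is said to appear in bag $t$ if $t$ is the topmost (closest to the root) bag with $u,v\in X_t$; $E_t$ is the set of edges appearing in $t$ (so each edge lies in exactly one $E_t$), and every leaf bag satisfies $E_t=\emptyset$. $E_{\mathcal{T}_t}=\bigcup_{s\in V(\mathcal{T}_t)}E_s$. A connection set over $S\subseteq V$ is a subset of $S\times S$; sets of edges are regarded as connection sets (an edge $uv$ giving the pairs $(u,v)$ and $(v,u)$). For a set $\Lambda$ of pairs, $\mathrm{tc}(\Lambda)$ is its transitive closure: all pairs $(w,w')$ such that there is a sequence $w=w_0,w_1,\dots,w_q=w'$ with $(w_i,w_{i+1})\in\Lambda$ for all $i<q$. The projection $\Lambda|_t$ is $\Lambda\cap(X_t\times X_t)$. -}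

module Defs where

open import Level using (0ℓ)
open import Data.Nat using (ℕ)
open import Data.Fin using (Fin)
open import Data.Product using (Σ; ∃; _×_)
open import Data.Sum using (_⊎_)
open import Data.Empty using (⊥)
open import Relation.Nullary using (¬_)
open import Relation.Unary using (Pred; _∈_)
open import Relation.Binary using (Rel; Symmetric)
open import Relation.Binary.PropositionalEquality using (_≡_)
open import Relation.Binary.Construct.Closure.Transitive using (TransClosure)
open import Function.Bundles using (_⇔_)

data Shape : Set where
  leaf : Shape
  node : Shape → Shape → Shape

data Pos : Shape → Set where
  here : ∀ {s} → Pos s
  goL  : ∀ {l r} → Pos l → Pos (node l r)
  goR  : ∀ {l r} → Pos r → Pos (node l r)

root : ∀ {s} → Pos s
root = here

sub : ∀ {s} → Pos s → Shape
sub {s} here = s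
sub (goL p) = sub p
sub (goR p) = sub p

IsLeaf : ∀ {s} → Pos s → Set
IsLeaf p = sub p ≡ leaf

data LChild : ∀ {s} → Pos s → Pos s → Set where
  lc-here : ∀ {l r} → LChild {node l r} here (goL here)
  lc-L    : ∀ {l r} {p q : Pos l} → LChild p q → LChild {node l r} (goL p) (goL q)
  lc-R    : ∀ {l r} {p q : Pos r} → LChild p q → LChild {node l r} (goR p) (goR q)

data RChild : ∀ {s} → Pos s → Pos s → Set where
  rc-here : ∀ {l r} → RChild {node l r} here (goR here)
  rc-L    : ∀ {l r} {p q : Pos l} → RChild p q → RChild {node l r} (goL p) (goL q)
  rc-R    : ∀ {l r} {p q : Pos r} → RChild p q → RChild {node l r} (goR p) (goR q)

-- Child p q : q is a child of p (equivalently p = parent(q)).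
Child : ∀ {s} → Pos s → Pos s → Set
Child p q = LChild p q ⊎ RChild p q

-- p ≼ q : p is an ancestor of q or p = q, i.e. q is a node of the subtree T_p.
data _≼_ : ∀ {s} → Pos s → Pos s → Set where
  ≼-here : ∀ {s} {q : Pos s} → here ≼ q
  ≼-L    : ∀ {l r} {p q : Pos l} → p ≼ q → _≼_ {node l r} (goL p) (goL q)
  ≼-R    : ∀ {l r} {p q : Pos r} → p ≼ q → _≼_ {node l r} (goR p) (goR q)

data WalkIn {s} (P : Pred (Pos s) 0ℓ) : Pos s → Pos s → Set where
  stay : ∀ {p} → P p → WalkIn P p p
  step : ∀ {p q r} → P p → (Child p q ⊎ Child q p) → WalkIn P q r → WalkIn P p r

record Graph (n : ℕ) : Set₁ where
  field
    E       : Rel (Fin n) 0ℓ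
    E-sym   : Symmetric E
    E-irrefl : ∀ {v} → ¬ E v v

record TreeDecomposition {n : ℕ} (G : Graph n) : Set₁ where
  open Graph G
  field
    shape : Shape
    X     : Pos shape → Pred (Fin n) 0ℓ
    vertex-cover : ∀ v → ∃ λ t → v ∈ X t
    edge-cover   : ∀ u v → E u v → ∃ λ t → u ∈ X t × v ∈ X t
    connected    : ∀ v t t' → v ∈ X t → v ∈ X t' → WalkIn (λ s → v ∈ X s) t t'

  -- edge uv appears in bag t: t is the topmost bag containing u and v.
  Appears : Pos shape → Rel (Fin n) 0ℓ
  Appears t u v = E u v × u ∈ X t × v ∈ X t
                  × (∀ s → u ∈ X s → v ∈ X s → t ≼ s)

  AppearsBelow : Pos shape → Rel (Fin n) 0ℓ
  AppearsBelow t u v = ∃ λ s → t ≼ s × Appears s u v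

_≐_ : ∀ {n} → Rel (Fin n) 0ℓ → Rel (Fin n) 0ℓ → Set
R ≐ S = ∀ u v → R u v ⇔ S u v

∅ : ∀ {n} → Rel (Fin n) 0ℓ
∅ _ _ = ⊥

_∪_ : ∀ {n} → Rel (Fin n) 0ℓ → Rel (Fin n) 0ℓ → Rel (Fin n) 0ℓ
(R ∪ S) u v = R u v ⊎ S u v

_∩_ : ∀ {n} → Rel (Fin n) 0ℓ → Rel (Fin n) 0ℓ → Rel (Fin n) 0ℓ
(R ∩ S) u v = R u v × S u v

-- A set of (undirected) edges regarded as a connection set.
asConn : ∀ {n} → Rel (Fin n) 0ℓ → Rel (Fin n) 0ℓ
asConn Y u v = Y u v ⊎ Y v u

tc : ∀ {n} → Rel (Fin n) 0ℓ → Rel (Fin n) 0ℓ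
tc R = TransClosure R

proj : ∀ {n} → Rel (Fin n) 0ℓ → Pred (Fin n) 0ℓ → Rel (Fin n) 0ℓ
proj Λ S u v = Λ u v × u ∈ S × v ∈ S

module _ {n : ℕ} {G : Graph n} (D : TreeDecomposition G) where
  open TreeDecomposition D

  EdgeSelection : (Pos shape → Rel (Fin n) 0ℓ) → Set
  EdgeSelection Y = ∀ t u v → Y t u v → Appears t u v

  ConnOver : (Pos shape → Rel (Fin n) 0ℓ) → Set
  ConnOver Γ = ∀ t u v → Γ t u v → u ∈ X t × v ∈ X t

  Yunion : (Pos shape → Rel (Fin n) 0ℓ) → Rel (Fin n) 0ℓ
  Yunion Y u v = ∃ λ t → asConn (Y t) u v

  LocalDef : (Y Γ Δ : Pos shape → Rel (Fin n) 0ℓ) → Set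
  LocalDef Y Γ Δ =
      (∀ t → IsLeaf t → Γ t ≐ ∅)
    × (∀ t t' t'' → LChild t t' → RChild t t'' →
         Γ t ≐ proj (tc ((Γ t' ∪ Γ t'') ∪ asConn (Y t))) (X t))
    × (Δ root ≐ Γ root)
    × (∀ p t → Child p t → Δ t ≐ proj (tc (Δ p ∪ Γ t)) (X t))

  GlobalDef : (Y Γ Δ : Pos shape → Rel (Fin n) 0ℓ) → Set
  GlobalDef Y Γ Δ =
      (∀ t → Γ t ≐ proj (tc (Yunion Y ∩ AppearsBelow t)) (X t))
    × (∀ t → Δ t ≐ proj (tc (Yunion Y)) (X t))

-- Let Γ*_t = tc(Y ∩ E_{T_t})|_t and Δ*_t = tc(Y)|_t.  Both directions follow
-- from four facts: Γ*_t = ∅ at a leaf; Γ*_t = tc(Γ*_{t'} ∪ Γ*_{t''} ∪ Y_t)|_t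
-- at an internal node; Δ*_root = Γ*_root; and Δ*_t = tc(Δ*_{p(t)} ∪ Γ*_t)|_t.
-- "Global ⇒ local" is then rewriting, "local ⇒ global" a bottom-up induction
-- for Γ followed by a top-down induction for Δ.
--
-- The two recursive facts rest on one principle.  Split the bags into blocks
-- (the child subtrees and t itself, resp. the inside and outside of T_t).
-- Where a Y-path switches from an edge of one block to an edge of another, the
-- shared vertex lies in X_t, since the bags containing it form a connected
-- subtree that must cross the tree edge above a child subtree.  Cutting the
-- path there (segmentation lemma) leaves single-block runs, each one edge of
-- the local relation.

module Submission where

open import Defs
open import Level using (0ℓ) renaming (suc to lsuc)
open import Data.Nat using (ℕ)
open import Data.Fin using (Fin)
open import Data.Product using (∃; _×_; _,_; proj₁; proj₂)
open import Data.Sum using (_⊎_; inj₁; inj₂)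
import Data.Sum as Sum
open import Data.Empty using (⊥; ⊥-elim)
open import Relation.Nullary using (¬_; Dec; yes; no)
open import Relation.Unary using (Pred; _∈_)
open import Relation.Binary using (Rel; Setoid; IsEquivalence; DecidableEquality)
open import Relation.Binary.PropositionalEquality using (_≡_; _≢_; refl; sym; cong; subst)
open import Relation.Binary.Construct.Closure.Transitive using (TransClosure; [_]; _∷_; _∷ʳ_; _++_)
open import Relation.Binary.Construct.Closure.ReflexiveTransitive using (Star; ε; _◅_)
open import Function.Bundles using (_⇔_; mk⇔; Equivalence)
import Function.Properties.Equivalence as ⇔
open Equivalence using (to; from)

module _ {A : Set} {R S : Rel A 0ℓ} where

  tc-map : (∀ {x y} → R x y → S x y) → ∀ {x y} → TransClosure R x y → TransClosure S x y
  tc-map f [ e ]   = [ f e ]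
  tc-map f (e ∷ π) = f e ∷ tc-map f π

  tc-concatMap : (∀ {x y} → R x y → TransClosure S x y) → ∀ {x y} → TransClosure R x y → TransClosure S x y
  tc-concatMap f [ e ]   = f e
  tc-concatMap f (e ∷ π) = f e ++ tc-concatMap f π

module _ {A : Set} {R : Rel A 0ℓ} where

  tc-head : ∀ {x y} → TransClosure R x y → ∃ λ z → R x z
  tc-head [ e ]   = _ , e
  tc-head (e ∷ _) = _ , e

  tc-last : ∀ {x y} → TransClosure R x y → ∃ λ w → R w y
  tc-last [ e ]   = _ , e
  tc-last (_ ∷ π) = tc-last π

  tc-uncons : ∀ {x y} → TransClosure R x y → ∃ λ z → R x z × Star R z y
  tc-uncons [ e ] = _ , e , ε
  tc-uncons (e ∷ π) with tc-uncons π
  ... | _ , e′ , ρ = _ , e , e′ ◅ ρ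

-- Edges of R k have colour k; where two
-- consecutive edges have different colours the middle vertex lies in the
-- separator S; and every one-coloured path between separator vertices gives a
-- T-path.  Then every path between separator vertices gives a T-path: cut it
-- at the colour changes into maximal one-coloured runs.
module Segmentation {A K : Set} (_≟_ : DecidableEquality K)
  (R : K → Rel A 0ℓ) (S : Pred A 0ℓ) (T : Rel A 0ℓ)
  (switch : ∀ {k k′ x y z} → R k x y → R k′ y z → k ≢ k′ → S y)
  (run : ∀ {k a b} → S a → S b → TransClosure (R k) a b → TransClosure T a b) where

  Coloured : Rel A 0ℓ
  Coloured a b = ∃ λ k → R k a b

  -- π is the current run, of colour k, and ρ is the rest of the path.
  segment : ∀ {k a x v} → S a → TransClosure (R k) a x → Star Coloured x v → S v → TransClosure T a v
  segment sa π ε sv = run sa sv π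
  segment {k} sa π ((k′ , e) ◅ ρ) sv with k ≟ k′
  ... | yes refl = segment sa (π ∷ʳ e) ρ sv
  ... | no k≢k′  = run sa sx π ++ segment sx [ e ] ρ sv
    where sx = switch (proj₂ (tc-last π)) e k≢k′

  segments : ∀ {a b} → S a → S b → TransClosure Coloured a b → TransClosure T a b
  segments sa sb π with tc-uncons π
  ... | _ , (_ , e) , ρ = segment sa [ e ] ρ sb

≼-refl : ∀ {s} (p : Pos s) → p ≼ p
≼-refl here    = ≼-here
≼-refl (goL p) = ≼-L (≼-refl p)
≼-refl (goR p) = ≼-R (≼-refl p)

≼-trans : ∀ {s} {p q r : Pos s} → p ≼ q → q ≼ r → p ≼ r
≼-trans ≼-here  _       = ≼-here
≼-trans (≼-L x) (≼-L y) = ≼-L (≼-trans x y)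
≼-trans (≼-R x) (≼-R y) = ≼-R (≼-trans x y)

≼-root : ∀ {s} {p : Pos s} → p ≼ here → p ≡ here
≼-root ≼-here = refl

≼-antisym : ∀ {s} {p q : Pos s} → p ≼ q → q ≼ p → p ≡ q
≼-antisym ≼-here  y       = sym (≼-root y)
≼-antisym (≼-L x) (≼-L y) = cong goL (≼-antisym x y)
≼-antisym (≼-R x) (≼-R y) = cong goR (≼-antisym x y)

_≼?_ : ∀ {s} (p q : Pos s) → Dec (p ≼ q)
here  ≼? q     = yes ≼-here
goL p ≼? here  = no λ ()
goL p ≼? goL q with p ≼? q
... | yes x = yes (≼-L x)
... | no ¬x = no λ { (≼-L x) → ¬x x }
goL p ≼? goR q = no λ ()
goR p ≼? here  = no λ ()
goR p ≼? goL q = no λ ()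
goR p ≼? goR q with p ≼? q
... | yes x = yes (≼-R x)
... | no ¬x = no λ { (≼-R x) → ¬x x }

lchild⇒≼ : ∀ {s} {p q : Pos s} → LChild p q → p ≼ q
lchild⇒≼ lc-here  = ≼-here
lchild⇒≼ (lc-L c) = ≼-L (lchild⇒≼ c)
lchild⇒≼ (lc-R c) = ≼-R (lchild⇒≼ c)

rchild⇒≼ : ∀ {s} {p q : Pos s} → RChild p q → p ≼ q
rchild⇒≼ rc-here  = ≼-here
rchild⇒≼ (rc-L c) = ≼-L (rchild⇒≼ c)
rchild⇒≼ (rc-R c) = ≼-R (rchild⇒≼ c)

child⇒≼ : ∀ {s} {p q : Pos s} → Child p q → p ≼ q
child⇒≼ = Sum.[ lchild⇒≼ , rchild⇒≼ ]

lchild-not-above : ∀ {s} {p q : Pos s} → LChild p q → ¬ q ≼ p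
lchild-not-above lc-here  ()
lchild-not-above (lc-L c) (≼-L x) = lchild-not-above c x
lchild-not-above (lc-R c) (≼-R x) = lchild-not-above c x

rchild-not-above : ∀ {s} {p q : Pos s} → RChild p q → ¬ q ≼ p
rchild-not-above rc-here  ()
rchild-not-above (rc-L c) (≼-L x) = rchild-not-above c x
rchild-not-above (rc-R c) (≼-R x) = rchild-not-above c x

lchild-ancestor : ∀ {s} {q a c : Pos s} → LChild q a → c ≼ a → c ≡ a ⊎ c ≼ q
lchild-ancestor lc-here   ≼-here  = inj₂ ≼-here
lchild-ancestor lc-here   (≼-L x) = inj₁ (cong goL (≼-root x))
lchild-ancestor (lc-L ch) ≼-here  = inj₂ ≼-here
lchild-ancestor (lc-L ch) (≼-L x) = Sum.map (cong goL) ≼-L (lchild-ancestor ch x)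
lchild-ancestor (lc-R ch) ≼-here  = inj₂ ≼-here
lchild-ancestor (lc-R ch) (≼-R x) = Sum.map (cong goR) ≼-R (lchild-ancestor ch x)

rchild-ancestor : ∀ {s} {q a c : Pos s} → RChild q a → c ≼ a → c ≡ a ⊎ c ≼ q
rchild-ancestor rc-here   ≼-here  = inj₂ ≼-here
rchild-ancestor rc-here   (≼-R x) = inj₁ (cong goR (≼-root x))
rchild-ancestor (rc-L ch) ≼-here  = inj₂ ≼-here
rchild-ancestor (rc-L ch) (≼-L x) = Sum.map (cong goL) ≼-L (rchild-ancestor ch x)
rchild-ancestor (rc-R ch) ≼-here  = inj₂ ≼-here
rchild-ancestor (rc-R ch) (≼-R x) = Sum.map (cong goR) ≼-R (rchild-ancestor ch x)

child-ancestor : ∀ {s} {q a c : Pos s} → Child q a → c ≼ a → c ≡ a ⊎ c ≼ q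
child-ancestor = Sum.[ lchild-ancestor , rchild-ancestor ]

lchild-parent-unique : ∀ {s} {p q c : Pos s} → LChild p c → LChild q c → p ≡ q
lchild-parent-unique lc-here  lc-here  = refl
lchild-parent-unique lc-here  (lc-L ())
lchild-parent-unique (lc-L ()) lc-here
lchild-parent-unique (lc-L a) (lc-L b) = cong goL (lchild-parent-unique a b)
lchild-parent-unique (lc-R a) (lc-R b) = cong goR (lchild-parent-unique a b)

rchild-parent-unique : ∀ {s} {p q c : Pos s} → RChild p c → RChild q c → p ≡ q
rchild-parent-unique rc-here  rc-here  = refl
rchild-parent-unique rc-here  (rc-R ())
rchild-parent-unique (rc-R ()) rc-here
rchild-parent-unique (rc-L a) (rc-L b) = cong goL (rchild-parent-unique a b)
rchild-parent-unique (rc-R a) (rc-R b) = cong goR (rchild-parent-unique a b)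

lchild-not-rchild : ∀ {s} {p q c : Pos s} → LChild p c → RChild q c → ⊥
lchild-not-rchild lc-here  (rc-L ())
lchild-not-rchild (lc-L a) (rc-L b) = lchild-not-rchild a b
lchild-not-rchild (lc-R a) (rc-R b) = lchild-not-rchild a b
lchild-not-rchild (lc-R ()) rc-here

parent-unique : ∀ {s} {p q c : Pos s} → Child p c → Child q c → p ≡ q
parent-unique (inj₁ a) (inj₁ b) = lchild-parent-unique a b
parent-unique (inj₁ a) (inj₂ b) = ⊥-elim (lchild-not-rchild a b)
parent-unique (inj₂ a) (inj₁ b) = ⊥-elim (lchild-not-rchild b a)
parent-unique (inj₂ a) (inj₂ b) = rchild-parent-unique a b

siblings-disjoint : ∀ {sh} {t a b s : Pos sh} → LChild t a → RChild t b → a ≼ s → ¬ b ≼ s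
siblings-disjoint lc-here  rc-here  (≼-L _) ()
siblings-disjoint (lc-L l) (rc-L r) (≼-L x) (≼-L y) = siblings-disjoint l r x y
siblings-disjoint (lc-R l) (rc-R r) (≼-R x) (≼-R y) = siblings-disjoint l r x y

subtree-split : ∀ {sh} {t a b : Pos sh} (s : Pos sh) → LChild t a → RChild t b → t ≼ s
              → s ≡ t ⊎ a ≼ s ⊎ b ≼ s
subtree-split here     lc-here  rc-here  ≼-here  = inj₁ refl
subtree-split (goL s)  lc-here  rc-here  ≼-here  = inj₂ (inj₁ (≼-L ≼-here))
subtree-split (goR s)  lc-here  rc-here  ≼-here  = inj₂ (inj₂ (≼-R ≼-here))
subtree-split (goL s)  (lc-L l) (rc-L r) (≼-L x) = Sum.map (cong goL) (Sum.map ≼-L ≼-L) (subtree-split s l r x)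
subtree-split (goR s)  (lc-R l) (rc-R r) (≼-R x) = Sum.map (cong goR) (Sum.map ≼-R ≼-R) (subtree-split s l r x)

leaf-subtree : ∀ {sh} {t s : Pos sh} → IsLeaf t → t ≼ s → s ≡ t
leaf-subtree {s = here}  _  ≼-here  = refl
leaf-subtree {s = goL _} () ≼-here
leaf-subtree {s = goR _} () ≼-here
leaf-subtree lf (≼-L x) = cong goL (leaf-subtree lf x)
leaf-subtree lf (≼-R x) = cong goR (leaf-subtree lf x)

bottom-up : ∀ {sh} (P : Pos sh → Set)
          → (∀ t → IsLeaf t → P t)
          → (∀ {t t₁ t₂} → LChild t t₁ → RChild t t₂ → P t₁ → P t₂ → P t)
          → ∀ t → P t
bottom-up {leaf}     P leaves nodes here    = leaves here refl
bottom-up {node _ _} P leaves nodes here    =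
  nodes lc-here rc-here (bottom-up (λ t → P (goL t)) (λ t → leaves (goL t)) (λ l r → nodes (lc-L l) (rc-L r)) here)
                        (bottom-up (λ t → P (goR t)) (λ t → leaves (goR t)) (λ l r → nodes (lc-R l) (rc-R r)) here)
bottom-up {node _ _} P leaves nodes (goL t) =
  bottom-up (λ t → P (goL t)) (λ t → leaves (goL t)) (λ l r → nodes (lc-L l) (rc-L r)) t
bottom-up {node _ _} P leaves nodes (goR t) =
  bottom-up (λ t → P (goR t)) (λ t → leaves (goR t)) (λ l r → nodes (lc-R l) (rc-R r)) t

top-down : ∀ {sh} (P : Pos sh → Set)
         → P here
         → (∀ {p t} → Child p t → P p → P t)
         → ∀ t → P t
top-down P base descend here = base
top-down P base descend (goL t) =
  top-down (λ t → P (goL t)) (descend (inj₁ lc-here) base) (λ c → descend (Sum.map lc-L rc-L c)) t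
top-down P base descend (goR t) =
  top-down (λ t → P (goR t)) (descend (inj₂ rc-here) base) (λ c → descend (Sum.map lc-R rc-R c)) t

walk-start : ∀ {sh} {P : Pred (Pos sh) 0ℓ} {p q} → WalkIn P p q → P p
walk-start (stay x)     = x
walk-start (step x _ _) = x

walk-exit : ∀ {sh} {P : Pred (Pos sh) 0ℓ} {a b c}
          → WalkIn P a b → c ≼ a → ¬ c ≼ b → ∃ λ q → Child q c × P q × P c
walk-exit (stay _) c≼a ¬c≼b = ⊥-elim (¬c≼b c≼a)
walk-exit {c = c} (step {q = q} pa adj w) c≼a ¬c≼b with c ≼? q
... | yes c≼q = walk-exit w c≼q ¬c≼b
... | no ¬c≼q with adj
...   | inj₁ a→q = ⊥-elim (¬c≼q (≼-trans c≼a (child⇒≼ a→q)))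
...   | inj₂ q→a with child-ancestor q→a c≼a
...     | inj₁ refl = q , q→a , walk-start w , pa
...     | inj₂ c≼q  = ⊥-elim (¬c≼q c≼q)

≐-isEquivalence : ∀ {n} → IsEquivalence (_≐_ {n})
≐-isEquivalence = record
  { refl  = λ _ _ → ⇔.refl
  ; sym   = λ e u v → ⇔.sym (e u v)
  ; trans = λ e f u v → ⇔.trans (e u v) (f u v)
  }

≐-setoid : ℕ → Setoid (lsuc 0ℓ) 0ℓ
≐-setoid n = record { isEquivalence = ≐-isEquivalence {n} }

module _ {n : ℕ} where
  open IsEquivalence (≐-isEquivalence {n}) using () renaming (refl to ≐-refl)

  ∪-cong : {R R′ S S′ : Rel (Fin n) 0ℓ} → R ≐ R′ → S ≐ S′ → (R ∪ S) ≐ (R′ ∪ S′)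
  ∪-cong e f u v = mk⇔ (Sum.map (to (e u v)) (to (f u v))) (Sum.map (from (e u v)) (from (f u v)))

  tc-proj-cong : {R S : Rel (Fin n) 0ℓ} {Z : Pred (Fin n) 0ℓ} → R ≐ S → proj (tc R) Z ≐ proj (tc S) Z
  tc-proj-cong e u v =
    mk⇔ (λ (π , a , b) → tc-map (λ {x} {y} → to (e x y)) π , a , b)
        (λ (π , a , b) → tc-map (λ {x} {y} → from (e x y)) π , a , b)

  internal-cong : {R₁ R₂ S₁ S₂ Y : Rel (Fin n) 0ℓ} {Z : Pred (Fin n) 0ℓ} → R₁ ≐ S₁ → R₂ ≐ S₂
                → proj (tc ((R₁ ∪ R₂) ∪ Y)) Z ≐ proj (tc ((S₁ ∪ S₂) ∪ Y)) Z
  internal-cong e₁ e₂ = tc-proj-cong (∪-cong (∪-cong e₁ e₂) ≐-refl)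

  child-cong : {R₁ R₂ S₁ S₂ : Rel (Fin n) 0ℓ} {Z : Pred (Fin n) 0ℓ} → R₁ ≐ S₁ → R₂ ≐ S₂
             → proj (tc (R₁ ∪ R₂)) Z ≐ proj (tc (S₁ ∪ S₂)) Z
  child-cong e₁ e₂ = tc-proj-cong (∪-cong e₁ e₂)

data Block : Set where
  left right top : Block

_≟-block_ : DecidableEquality Block
left  ≟-block left  = yes refl
left  ≟-block right = no λ ()
left  ≟-block top   = no λ ()
right ≟-block left  = no λ ()
right ≟-block right = yes refl
right ≟-block top   = no λ ()
top   ≟-block left  = no λ ()
top   ≟-block right = no λ ()
top   ≟-block top   = yes refl

data Side : Set where
  inside outside : Side

_≟-side_ : DecidableEquality Side
inside  ≟-side inside  = yes refl
inside  ≟-side outside = no λ ()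
outside ≟-side inside  = no λ ()
outside ≟-side outside = yes refl

module Connectivity {n : ℕ} {G : Graph n} (D : TreeDecomposition G)
  (no-leaf-edges : ∀ t → IsLeaf t → ∀ u v → ¬ TreeDecomposition.Appears D t u v)
  (Y : Pos (TreeDecomposition.shape D) → Rel (Fin n) 0ℓ)
  (Y⊆E : EdgeSelection D Y) where
  open Graph G
  open TreeDecomposition D
  open IsEquivalence (≐-isEquivalence {n}) using () renaming (trans to ≐-trans)
  open import Relation.Binary.Reasoning.Setoid (≐-setoid n)

  Node : Set
  Node = Pos shape

  Yu : Rel (Fin n) 0ℓ
  Yu = Yunion D Y

  GlobalΓ : Node → Rel (Fin n) 0ℓ
  GlobalΓ t = proj (tc (Yu ∩ AppearsBelow t)) (X t)

  GlobalΔ : Node → Rel (Fin n) 0ℓ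
  GlobalΔ t = proj (tc Yu) (X t)

  appears-sym : ∀ {s u v} → Appears s u v → Appears s v u
  appears-sym (e , xu , xv , topmost) = E-sym e , xv , xu , λ r a b → topmost r b a

  appears-unique : ∀ {s s′ u v} → Appears s u v → Appears s′ u v → s ≡ s′
  appears-unique (_ , xu , xv , topmost) (_ , xu′ , xv′ , topmost′) = ≼-antisym (topmost _ xu′ xv′) (topmost′ _ xu xv)

  selected-appears : ∀ {s u v} → asConn (Y s) u v → Appears s u v
  selected-appears (inj₁ y) = Y⊆E _ _ _ y
  selected-appears (inj₂ y) = appears-sym (Y⊆E _ _ _ y)

  selected-in₁ : ∀ {s u v} → asConn (Y s) u v → u ∈ X s
  selected-in₁ y = proj₁ (proj₂ (selected-appears y))

  selected-in₂ : ∀ {s u v} → asConn (Y s) u v → v ∈ X s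
  selected-in₂ y = proj₁ (proj₂ (proj₂ (selected-appears y)))

  exit-child : ∀ {w a b c} → w ∈ X a → w ∈ X b → c ≼ a → ¬ c ≼ b → w ∈ X c
  exit-child {w} wa wb c≼a ¬c≼b = proj₂ (proj₂ (proj₂ (walk-exit (connected w _ _ wa wb) c≼a ¬c≼b)))

  exit-parent : ∀ {w a b c p} → Child p c → w ∈ X a → w ∈ X b → c ≼ a → ¬ c ≼ b → w ∈ X p
  exit-parent {w} p→c wa wb c≼a ¬c≼b with walk-exit (connected w _ _ wa wb) c≼a ¬c≼b
  ... | q , q→c , wq , _ = subst (λ z → w ∈ X z) (parent-unique q→c p→c) wq

  below-mono : ∀ {t c a b} → t ≼ c → (Yu ∩ AppearsBelow c) a b → (Yu ∩ AppearsBelow t) a b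
  below-mono t≼c (y , s , c≼s , app) = y , s , ≼-trans t≼c c≼s , app

  SelectedBelow : Node → Rel (Fin n) 0ℓ
  SelectedBelow c a b = ∃ λ s → asConn (Y s) a b × c ≼ s

  selected-below : ∀ {c a b} → SelectedBelow c a b → (Yu ∩ AppearsBelow c) a b
  selected-below (s , y , c≼s) = (s , y) , (s , c≼s , selected-appears y)

  below-run : ∀ {c s a b} → ¬ c ≼ s → a ∈ X s → b ∈ X s → TransClosure (SelectedBelow c) a b → GlobalΓ c a b
  below-run ¬c≼s as bs π with tc-head π | tc-last π
  ... | _ , (_ , y₁ , c≼s₁) | _ , (_ , y₂ , c≼s₂) =
    tc-map selected-below π , exit-child (selected-in₁ y₁) as c≼s₁ ¬c≼s , exit-child (selected-in₂ y₂) bs c≼s₂ ¬c≼s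

  -- (leaf) No edge appears below a leaf, so Γ* vanishes there.
  Γ*-leaf : ∀ t → IsLeaf t → GlobalΓ t ≐ ∅
  Γ*-leaf t lf u v = mk⇔ no-path λ ()
    where
    no-path : GlobalΓ t u v → ⊥
    no-path (π , _) with tc-head π
    ... | w , (_ , s , t≼s , app) = no-leaf-edges t lf u w (subst (λ z → Appears z u w) (leaf-subtree lf t≼s) app)

  -- (root) Every selected edge appears below the root.
  Δ*-root : GlobalΔ root ≐ GlobalΓ root
  Δ*-root u v = mk⇔ (λ (π , a , b) → tc-map (λ (s , y) → (s , y) , (s , ≼-here , selected-appears y)) π , a , b)
                    (λ (π , a , b) → tc-map proj₁ π , a , b)

  module InternalNode {t t₁ t₂ : Node} (l : LChild t t₁) (r : RChild t t₂) where

    InBlock : Block → Node → Set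
    InBlock left  s = t₁ ≼ s
    InBlock right s = t₂ ≼ s
    InBlock top   s = s ≡ t

    SelectedIn : Block → Rel (Fin n) 0ℓ
    SelectedIn k a b = ∃ λ s → asConn (Y s) a b × InBlock k s

    LocalRel : Rel (Fin n) 0ℓ
    LocalRel = (GlobalΓ t₁ ∪ GlobalΓ t₂) ∪ asConn (Y t)

    blocks-separated : ∀ {k k′ s s′} → InBlock k s → InBlock k′ s′ → k ≢ k′
                     → ∃ λ c → Child t c × (c ≼ s × ¬ c ≼ s′ ⊎ c ≼ s′ × ¬ c ≼ s)
    blocks-separated {left}  {left}  _ _    k≢k′ = ⊥-elim (k≢k′ refl)
    blocks-separated {left}  {right} x y    _    = t₁ , inj₁ l , inj₁ (x , λ x′ → siblings-disjoint l r x′ y)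
    blocks-separated {left}  {top}   x refl _    = t₁ , inj₁ l , inj₁ (x , lchild-not-above l)
    blocks-separated {right} {left}  x y    _    = t₁ , inj₁ l , inj₂ (y , λ y′ → siblings-disjoint l r y′ x)
    blocks-separated {right} {right} _ _    k≢k′ = ⊥-elim (k≢k′ refl)
    blocks-separated {right} {top}   x refl _    = t₂ , inj₂ r , inj₁ (x , rchild-not-above r)
    blocks-separated {top}   {left}  refl y _    = t₁ , inj₁ l , inj₂ (y , lchild-not-above l)
    blocks-separated {top}   {right} refl y _    = t₂ , inj₂ r , inj₂ (y , rchild-not-above r)
    blocks-separated {top}   {top}   _ _    k≢k′ = ⊥-elim (k≢k′ refl)

    switch : ∀ {k k′ x y z} → SelectedIn k x y → SelectedIn k′ y z → k ≢ k′ → y ∈ X t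
    switch (_ , e , ks) (_ , e′ , ks′) k≢k′ with blocks-separated ks ks′ k≢k′
    ... | _ , t→c , inj₁ (c≼s , ¬c≼s′) = exit-parent t→c (selected-in₂ e) (selected-in₁ e′) c≼s ¬c≼s′
    ... | _ , t→c , inj₂ (c≼s′ , ¬c≼s) = exit-parent t→c (selected-in₁ e′) (selected-in₂ e) c≼s′ ¬c≼s

    run : ∀ {k a b} → a ∈ X t → b ∈ X t → TransClosure (SelectedIn k) a b → TransClosure LocalRel a b
    run {left}  a b π = [ inj₁ (inj₁ (below-run (lchild-not-above l) a b π)) ]
    run {right} a b π = [ inj₁ (inj₂ (below-run (rchild-not-above r) a b π)) ]
    run {top}   _ _ π = tc-map (λ { (_ , y , refl) → inj₂ y }) π

    classify : ∀ {a b} → (Yu ∩ AppearsBelow t) a b → ∃ λ k → SelectedIn k a b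
    classify ((s , y) , (s′ , t≼s′ , app)) with subtree-split s l r (subst (t ≼_) (appears-unique app (selected-appears y)) t≼s′)
    ... | inj₁ s≡t          = top   , s , y , s≡t
    ... | inj₂ (inj₁ t₁≼s) = left  , s , y , t₁≼s
    ... | inj₂ (inj₂ t₂≼s) = right , s , y , t₂≼s

    open Segmentation _≟-block_ SelectedIn (λ z → z ∈ X t) LocalRel switch run

    local-edge : ∀ {a b} → LocalRel a b → tc (Yu ∩ AppearsBelow t) a b
    local-edge (inj₁ (inj₁ (π , _))) = tc-map (below-mono (lchild⇒≼ l)) π
    local-edge (inj₁ (inj₂ (π , _))) = tc-map (below-mono (rchild⇒≼ r)) π
    local-edge (inj₂ y) = [ (t , y) , t , ≼-refl t , selected-appears y ]

    Γ*-split : GlobalΓ t ≐ proj (tc LocalRel) (X t)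
    Γ*-split u v = mk⇔ (λ (π , a , b) → segments a b (tc-map classify π) , a , b)
                       (λ (π , a , b) → tc-concatMap local-edge π , a , b)

  module NonRootNode {p t : Node} (p→t : Child p t) where

    OnSide : Side → Node → Set
    OnSide inside  s = t ≼ s
    OnSide outside s = ¬ t ≼ s

    SelectedOn : Side → Rel (Fin n) 0ℓ
    SelectedOn k a b = ∃ λ s → asConn (Y s) a b × OnSide k s

    LocalRel : Rel (Fin n) 0ℓ
    LocalRel = GlobalΔ p ∪ GlobalΓ t

    switch : ∀ {k k′ x y z} → SelectedOn k x y → SelectedOn k′ y z → k ≢ k′ → y ∈ X t
    switch {inside}  {inside}  _ _ k≢k′ = ⊥-elim (k≢k′ refl)
    switch {inside}  {outside} (_ , e , t≼s) (_ , e′ , ¬t≼s′) _ = exit-child (selected-in₂ e) (selected-in₁ e′) t≼s ¬t≼s′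
    switch {outside} {inside}  (_ , e , ¬t≼s) (_ , e′ , t≼s′) _ = exit-child (selected-in₁ e′) (selected-in₂ e) t≼s′ ¬t≼s
    switch {outside} {outside} _ _ k≢k′ = ⊥-elim (k≢k′ refl)

    -- A run inside T_t is a Γ*_t-edge; a run outside T_t enters X_t from the
    -- parent's bag, so it is a Δ*_p-edge.
    run : ∀ {k a b} → a ∈ X t → b ∈ X t → TransClosure (SelectedOn k) a b → TransClosure LocalRel a b
    run {inside}  a b π = [ inj₂ (tc-map selected-below π , a , b) ]
    run {outside} a b π with tc-head π | tc-last π
    ... | _ , (_ , y₁ , ¬t≼s₁) | _ , (_ , y₂ , ¬t≼s₂) =
      [ inj₁ (tc-map (λ (s , y , _) → s , y) π
             , exit-parent p→t a (selected-in₁ y₁) (≼-refl t) ¬t≼s₁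
             , exit-parent p→t b (selected-in₂ y₂) (≼-refl t) ¬t≼s₂) ]

    classify : ∀ {a b} → Yu a b → ∃ λ k → SelectedOn k a b
    classify (s , y) with t ≼? s
    ... | yes t≼s = inside  , s , y , t≼s
    ... | no ¬t≼s = outside , s , y , ¬t≼s

    open Segmentation _≟-side_ SelectedOn (λ z → z ∈ X t) LocalRel switch run

    local-edge : ∀ {a b} → LocalRel a b → tc Yu a b
    local-edge (inj₁ (π , _)) = π
    local-edge (inj₂ (π , _)) = tc-map proj₁ π

    Δ*-split : GlobalΔ t ≐ proj (tc LocalRel) (X t)
    Δ*-split u v = mk⇔ (λ (π , a , b) → segments a b (tc-map classify π) , a , b)
                       (λ (π , a , b) → tc-concatMap local-edge π , a , b)

  module _ (Γ Δ : Node → Rel (Fin n) 0ℓ) where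

    global⇒local : GlobalDef D Y Γ Δ → LocalDef D Y Γ Δ
    global⇒local (gΓ , gΔ) = leaves , internal , at-root , children
      where
      leaves : ∀ t → IsLeaf t → Γ t ≐ ∅
      leaves t lf = ≐-trans (gΓ t) (Γ*-leaf t lf)
      internal : ∀ t t₁ t₂ → LChild t t₁ → RChild t t₂ → Γ t ≐ proj (tc ((Γ t₁ ∪ Γ t₂) ∪ asConn (Y t))) (X t)
      internal t t₁ t₂ l r = begin
        Γ t                                                             ≈⟨ gΓ t ⟩
        GlobalΓ t                                                       ≈⟨ InternalNode.Γ*-split l r ⟩
        proj (tc ((GlobalΓ t₁ ∪ GlobalΓ t₂) ∪ asConn (Y t))) (X t)     ≈⟨ internal-cong (gΓ t₁) (gΓ t₂) ⟨
        proj (tc ((Γ t₁ ∪ Γ t₂) ∪ asConn (Y t))) (X t)                 ∎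
      at-root : Δ root ≐ Γ root
      at-root = begin Δ root ≈⟨ gΔ root ⟩ GlobalΔ root ≈⟨ Δ*-root ⟩ GlobalΓ root ≈⟨ gΓ root ⟨ Γ root ∎
      children : ∀ p t → Child p t → Δ t ≐ proj (tc (Δ p ∪ Γ t)) (X t)
      children p t p→t = begin
        Δ t                                         ≈⟨ gΔ t ⟩
        GlobalΔ t                                   ≈⟨ NonRootNode.Δ*-split p→t ⟩
        proj (tc (GlobalΔ p ∪ GlobalΓ t)) (X t)     ≈⟨ child-cong (gΔ p) (gΓ t) ⟨
        proj (tc (Δ p ∪ Γ t)) (X t)                 ∎

    local⇒global : LocalDef D Y Γ Δ → GlobalDef D Y Γ Δ
    local⇒global (leaves , internal , at-root , children) = Γ≐Γ* , Δ≐Δ*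
      where
      Γ≐Γ* : ∀ t → Γ t ≐ GlobalΓ t
      Γ≐Γ* = bottom-up (λ t → Γ t ≐ GlobalΓ t)
        (λ t lf → begin Γ t ≈⟨ leaves t lf ⟩ ∅ ≈⟨ Γ*-leaf t lf ⟨ GlobalΓ t ∎)
        (λ {t} {t₁} {t₂} l r e₁ e₂ → begin
          Γ t                                                            ≈⟨ internal t t₁ t₂ l r ⟩
          proj (tc ((Γ t₁ ∪ Γ t₂) ∪ asConn (Y t))) (X t)                ≈⟨ internal-cong e₁ e₂ ⟩
          proj (tc ((GlobalΓ t₁ ∪ GlobalΓ t₂) ∪ asConn (Y t))) (X t)    ≈⟨ InternalNode.Γ*-split l r ⟨
          GlobalΓ t                                                      ∎)
      Δ≐Δ* : ∀ t → Δ t ≐ GlobalΔ t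
      Δ≐Δ* = top-down (λ t → Δ t ≐ GlobalΔ t)
        (begin Δ root ≈⟨ at-root ⟩ Γ root ≈⟨ Γ≐Γ* root ⟩ GlobalΓ root ≈⟨ Δ*-root ⟨ GlobalΔ root ∎)
        (λ {p} {t} p→t e → begin
          Δ t                                        ≈⟨ children p t p→t ⟩
          proj (tc (Δ p ∪ Γ t)) (X t)                ≈⟨ child-cong e (Γ≐Γ* t) ⟩
          proj (tc (GlobalΔ p ∪ GlobalΓ t)) (X t)    ≈⟨ NonRootNode.Δ*-split p→t ⟨
          GlobalΔ t                                  ∎)

    local⇔global : LocalDef D Y Γ Δ ⇔ GlobalDef D Y Γ Δ
    local⇔global = mk⇔ local⇒global global⇒local

lemma6 : ∀ {n : ℕ} (G : Graph n) (D : TreeDecomposition G)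
       → (∀ t → IsLeaf t → ∀ u v → ¬ TreeDecomposition.Appears D t u v)
       → (Y Γ Δ : Pos (TreeDecomposition.shape D) → Rel (Fin n) 0ℓ)
       → EdgeSelection D Y → ConnOver D Γ → ConnOver D Δ
       → LocalDef D Y Γ Δ ⇔ GlobalDef D Y Γ Δ
lemma6 G D no-leaf-edges Y Γ Δ Y⊆E _ _ = Connectivity.local⇔global D no-leaf-edges Y Y⊆E Γ Δ
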